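{- Consider the PDSTSP setting described in the context. For every subset $S \subseteq V_c$ with $S\cap V_t\neq\varnothing$ and $|S| \geq 3$, every feasible PDSTSP solution $(x,y)$ satisfies $$\sum_{i, j \in S:\, i<j} x_{ij} \leq \sum_{k \in S} y_k - 1 .$$
   Context: Parallel Drone Scheduling Traveling Salesman Problem (PDSTSP). There is a complete undirected graph $G=(V,E)$ with $V=\{0,1,\dots,n,n+1\}$ and $E=\{(i,j): i,j\in V,\ i<j\}$. Vertex $0$ is the depot and vertex $n+1$ is a copy of the depot. The customers are $V_c=\{1,\dots,n\}$. A subset $V_d\subseteq V_c$ consists of drone-eligible customers, and $V_t=V_c\setminus V_d$ are the customers that must be served by the truck. The variables are binary $x_{ij}$ for edges $(i,j)\in E$ (equal to 1 if the truck travels edge $(i,j)$) and binary $y_i$ for $i \in V$ (equal to 1 if vertex $i$ is visited by the truck), with $y_0=y_{n+1}=1$. Each customer with $y_i=0$ is served by one of the drones via back-and-forth trips from the depot; the drone variables are irrelevant here. A pair $(x,y)$ is a feasible PDSTSP solution if: $y_i=1$ for all $i\in V_t$; and $x$ is the incidence vector of the edge set of a simple path in $G$ from $0$ to $n+1$ whose interior vertices are exactly the customers $i\in V_c$ with $y_i=1$. In particular, every customer $j$ satisfies $\sum_{i<j}x_{ij}+\sum_{k>j}x_{jk}=2y_j$. -}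

module Defs where

open import Data.Nat using (ℕ; zero; suc; _+_; _≤_)
open import Data.Bool using (Bool; true; false; if_then_else_; _∧_)
open import Data.Fin using (Fin; fromℕ; _<_)
import Data.Fin as F
open import Data.Fin.Subset using (Subset; _∈_; _∉_)
open import Data.Fin.Subset.Properties using (_∈?_)
open import Data.List using (List; []; _∷_; _++_; [_]; map)
open import Data.Nat.ListAction using () renaming (sum to lsum)
open import Data.List.Relation.Unary.Unique.Propositional using (Unique)
import Data.List.Membership.Propositional as LM
open import Data.Product using (Σ; _×_; ∃)
open import Data.Sum using (_⊎_)
open import Function.Bundles using (_⇔_)
open import Relation.Binary.PropositionalEquality using (_≡_)
open import Relation.Nullary using (¬_)
open import Relation.Nullary.Decidable using (⌊_⌋)
open import Data.Fin.Base using (toℕ)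
open import Data.List using (allFin)

V : ℕ → Set
V n = Fin (suc (suc n))

depot : ∀ {n} → V n
depot = F.zero

depot' : ∀ {n} → V n          -- the copy n+1 of the depot
depot' {n} = fromℕ (suc n)

IsCustomer : ∀ {n} → V n → Set
IsCustomer i = ¬ (i ≡ depot) × ¬ (i ≡ depot')

data Consecutive {A : Set} : List A → A → A → Set where
  here  : ∀ {a b l} → Consecutive (a ∷ b ∷ l) a b
  there : ∀ {c a b l} → Consecutive l a b → Consecutive (c ∷ l) a b

b2n : Bool → ℕ
b2n true  = 1
b2n false = 0

-- Feasible PDSTSP solution (x,y) for drone-eligible set Vd.
-- x i j is only meaningful for i < j (edges (i,j) with i<j).
record Feasible (n : ℕ) (Vd : Subset (suc (suc n)))
                (x : V n → V n → Bool) (y : V n → Bool) : Set where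
  field
    y-depot   : y depot ≡ true
    y-depot'  : y depot' ≡ true
    truck     : ∀ i → IsCustomer i → i ∉ Vd → y i ≡ true
    -- the truck path 0, interior..., n+1 as a list of vertices
    interior  : List (V n)
    simple    : Unique (depot ∷ interior ++ [ depot' ])
    interiorY : ∀ i → IsCustomer i → (LM._∈_ i interior ⇔ y i ≡ true)
    incidence : ∀ i j → i < j →
                (x i j ≡ true ⇔
                  (Consecutive (depot ∷ interior ++ [ depot' ]) i j
                   ⊎ Consecutive (depot ∷ interior ++ [ depot' ]) j i))

edgeSum : ∀ {n} → Subset (suc (suc n)) → (V n → V n → Bool) → ℕ
edgeSum S x =
  lsum (map (λ i → lsum (map (λ j →
     if ⌊ i ∈? S ⌋ ∧ ⌊ j ∈? S ⌋ ∧ ⌊ i F.<? j ⌋ then b2n (x i j) else 0)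
     (allFin _))) (allFin _))

ySum : ∀ {n} → Subset (suc (suc n)) → (V n → Bool) → ℕ
ySum S y = lsum (map (λ k → if ⌊ k ∈? S ⌋ then b2n (y k) else 0) (allFin _))

-- Orient every truck edge inside S along the path and charge it to its head. A vertex of S
-- has at most one predecessor on a simple path, and the first vertex of S on the path (which
-- exists because some truck customer lies in S) has none, so the edges inside S number at
-- most one less than the vertices of S on the path, i.e. than the sum of y over S.
module Submission where

open import Defs
open import Data.Nat using (ℕ; suc; _+_; _*_; _≤_; _<_; z≤n; s≤s)
open import Data.Nat.ListAction using () renaming (sum to lsum)
open import Data.Nat.Properties
  using (+-0-commutativeMonoid; ≤-refl; ≤-reflexive; ≤-trans; +-mono-≤; +-mono-<-≤; +-mono-≤-<;
         +-comm; +-identityʳ; m≤m+n; m≤n+m; *-identityˡ; *-distribˡ-+; module ≤-Reasoning)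
open import Algebra.Properties.CommutativeMonoid.Sum +-0-commutativeMonoid
  using (sum; sum-syntax; sum-cong-≗; sum-replicate-zero; ∑-distrib-+; ∑-comm)
open import Data.Bool using (Bool; true; false; if_then_else_; _∧_)
open import Data.Fin using (Fin; zero; suc; _≟_)
import Data.Fin as F
open import Data.Fin.Properties using (<-asym; 0≢1+n; suc-injective)
open import Data.Fin.Subset using (Subset; _∈_; _∉_; ∣_∣)
open import Data.Fin.Subset.Properties using (_∈?_)
open import Data.List using (List; []; _∷_; _++_; [_]; map; tabulate; allFin)
open import Data.List.Membership.Propositional using () renaming (_∈_ to _∈ₗ_)
open import Data.List.Membership.Propositional.Properties using (∈-++⁺ˡ; ∈-++⁻)
open import Data.List.Relation.Unary.All.Properties using (All¬⇒¬Any)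
open import Data.List.Relation.Unary.AllPairs using (_∷_)
open import Data.List.Relation.Unary.Any using (here; there; any?)
open import Data.List.Relation.Unary.Unique.Propositional using (Unique)
open import Data.Product using (Σ; _×_; _,_; ∃-syntax)
open import Data.Sum using (inj₁; inj₂)
open import Data.Empty using (⊥-elim)
open import Function using (_∘_; id)
open import Function.Bundles using (Equivalence)
open import Level using (Level)
open import Relation.Binary.Definitions using (DecidableEquality)
open import Relation.Binary.PropositionalEquality using (_≡_; refl; sym; trans; cong; subst₂)
open import Relation.Nullary using (¬_; Dec; yes; no)
open import Relation.Nullary.Decidable using (⌊_⌋; _×-dec_)
open import Relation.Unary using (Pred; Decidable)

private
  variable
    a p : Level
    A : Set a
    m : ℕ

𝟙 : {P : Set p} → Dec P → ℕ
𝟙 d = b2n ⌊ d ⌋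

𝟙-yes : {P : Set p} (d : Dec P) → P → 𝟙 d ≡ 1
𝟙-yes (yes _) _  = refl
𝟙-yes (no ¬P) P′ = ⊥-elim (¬P P′)

𝟙-no : {P : Set p} (d : Dec P) → ¬ P → 𝟙 d ≡ 0
𝟙-no (yes P′) ¬P = ⊥-elim (¬P P′)
𝟙-no (no _)   _  = refl

lsum-map-allFin : (f : Fin m → ℕ) → lsum (map f (allFin m)) ≡ sum f
lsum-map-allFin f = go f id
  where
  go : ∀ {k} (f : A → ℕ) (g : Fin k → A) → lsum (map f (tabulate g)) ≡ sum (f ∘ g)
  go {k = ℕ.zero} f g = refl
  go {k = suc k}  f g = cong (f (g zero) +_) (go f (g ∘ suc))

∑-≡0 : {f : Fin m → ℕ} → (∀ i → f i ≡ 0) → sum f ≡ 0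
∑-≡0 {m} f≡0 = trans (sum-cong-≗ f≡0) (sum-replicate-zero m)

∑-mono-≤ : {f g : Fin m → ℕ} → (∀ i → f i ≤ g i) → sum f ≤ sum g
∑-mono-≤ {ℕ.zero} _   = z≤n
∑-mono-≤ {suc m}  f≤g = +-mono-≤ (f≤g zero) (∑-mono-≤ (f≤g ∘ suc))

∑-mono-< : {f g : Fin m → ℕ} → (∀ i → f i ≤ g i) → ∀ i → f i < g i → sum f < sum g
∑-mono-< f≤g zero    f<g = +-mono-<-≤ f<g (∑-mono-≤ (f≤g ∘ suc))
∑-mono-< f≤g (suc i) f<g = +-mono-≤-< (f≤g zero) (∑-mono-< (f≤g ∘ suc) i f<g)

∑-𝟙-≤1 : {P : Pred (Fin m) p} (P? : Decidable P) →
         (∀ {i j} → P i → P j → i ≡ j) → ∑[ i < m ] 𝟙 (P? i) ≤ 1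
∑-𝟙-≤1 {ℕ.zero} P? _ = z≤n
∑-𝟙-≤1 {suc m}  P? P-unique with P? zero
... | yes P0 = ≤-reflexive (cong suc (∑-≡0 λ i → 𝟙-no (P? (suc i)) (0≢1+n ∘ P-unique P0)))
... | no _   = ∑-𝟙-≤1 (P? ∘ suc) (λ Pi Pj → suc-injective (P-unique Pi Pj))

∑∑-distrib-+ : (f g : Fin m → Fin m → ℕ) →
  ∑[ i < m ] ∑[ j < m ] (f i j + g i j) ≡ ∑[ i < m ] ∑[ j < m ] f i j + ∑[ i < m ] ∑[ j < m ] g i j
∑∑-distrib-+ f g =
  trans (sum-cong-≗ λ i → ∑-distrib-+ (f i) (g i)) (∑-distrib-+ (λ i → sum (f i)) (λ i → sum (g i)))

∑∑-upperTriangle-≤ : (f : Fin m → Fin m → ℕ) →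
  ∑[ i < m ] ∑[ j < m ] (𝟙 (i F.<? j) * (f i j + f j i)) ≤ ∑[ i < m ] ∑[ j < m ] f i j
∑∑-upperTriangle-≤ {m} f = begin
  ∑[ i < m ] ∑[ j < m ] (𝟙 (i F.<? j) * (f i j + f j i))
    ≡⟨ sum-cong-≗ (λ i → sum-cong-≗ λ j → *-distribˡ-+ (𝟙 (i F.<? j)) (f i j) (f j i)) ⟩
  ∑[ i < m ] ∑[ j < m ] (upper i j + lower j i)
    ≡⟨ ∑∑-distrib-+ upper (λ i j → lower j i) ⟩
  ∑[ i < m ] ∑[ j < m ] upper i j + ∑[ i < m ] ∑[ j < m ] lower j i
    ≡⟨ cong (∑[ i < m ] ∑[ j < m ] upper i j +_) (∑-comm (λ i j → lower j i)) ⟩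
  ∑[ i < m ] ∑[ j < m ] upper i j + ∑[ j < m ] ∑[ i < m ] lower j i
    ≡⟨ sym (∑∑-distrib-+ upper lower) ⟩
  ∑[ i < m ] ∑[ j < m ] (upper i j + lower i j)
    ≤⟨ ∑-mono-≤ (λ i → ∑-mono-≤ λ j → one-orientation (i F.<? j) (j F.<? i) (f i j)) ⟩
  ∑[ i < m ] ∑[ j < m ] f i j ∎
  where
  open ≤-Reasoning
  upper lower : Fin m → Fin m → ℕ
  upper i j = 𝟙 (i F.<? j) * f i j
  lower i j = 𝟙 (j F.<? i) * f i j
  one-orientation : ∀ {i j : Fin m} (i<j? : Dec (i F.< j)) (j<i? : Dec (j F.< i)) k →
                    𝟙 i<j? * k + 𝟙 j<i? * k ≤ k
  one-orientation (yes i<j) (yes j<i) k = ⊥-elim (<-asym i<j j<i)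
  one-orientation (yes _)   (no _)    k = ≤-reflexive (trans (+-identityʳ (k + 0)) (+-identityʳ k))
  one-orientation (no _)    (yes _)   k = ≤-reflexive (+-identityʳ k)
  one-orientation (no _)    (no _)    k = z≤n

Consecutive⇒∈ʳ : {l : List A} {u v : A} → Consecutive l u v → v ∈ₗ l
Consecutive⇒∈ʳ here      = there (here refl)
Consecutive⇒∈ʳ (there c) = there (Consecutive⇒∈ʳ c)

Consecutive-∷⇒∈ : {l : List A} {u v : A} → Consecutive (v ∷ l) u v → v ∈ₗ l
Consecutive-∷⇒∈ here      = here refl
Consecutive-∷⇒∈ (there c) = Consecutive⇒∈ʳ c

predecessor-unique : {l : List A} {u u′ v : A} → Unique l →
                     Consecutive l u v → Consecutive l u′ v → u ≡ u′
predecessor-unique _                here      here      = refl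
predecessor-unique (_ ∷ (v∉ ∷ _))   here      (there c) = ⊥-elim (All¬⇒¬Any v∉ (Consecutive-∷⇒∈ c))
predecessor-unique (_ ∷ (v∉ ∷ _))   (there c) here      = ⊥-elim (All¬⇒¬Any v∉ (Consecutive-∷⇒∈ c))
predecessor-unique (_ ∷ l!)         (there c) (there c′) = predecessor-unique l! c c′

consecutive? : DecidableEquality A → ∀ l (u v : A) → Dec (Consecutive l u v)
consecutive? _≟_ []          u v = no λ ()
consecutive? _≟_ (w ∷ [])    u v = no λ { (there ()) }
consecutive? _≟_ (w ∷ w′ ∷ l) u v with consecutive? _≟_ (w′ ∷ l) u v | w ≟ u | w′ ≟ v
... | yes c | _        | _        = yes (there c)
... | no ¬c | yes refl | yes refl = yes here
... | no ¬c | no w≢u   | _        = no λ { here → w≢u refl ; (there c) → ¬c c }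
... | no ¬c | yes refl | no w′≢v  = no λ { here → w′≢v refl ; (there c) → ¬c c }

first-satisfying : {P : Pred A p} → Decidable P → {l : List A} → Unique l →
                   ∀ {v} → v ∈ₗ l → P v →
                   ∃[ t ] t ∈ₗ l × P t × (∀ {u} → P u → ¬ Consecutive l u t)
first-satisfying P? {w ∷ l} (w∉ ∷ l!) v∈l Pv with P? w | v∈l
... | yes Pw | _         = w , here refl , Pw , λ _ c → All¬⇒¬Any w∉ (Consecutive-∷⇒∈ c)
... | no ¬Pw | here refl = ⊥-elim (¬Pw Pv)
... | no ¬Pw | there v∈l′ with first-satisfying P? l! v∈l′ Pv
...   | t , t∈l , Pt , t-first =
        t , there t∈l , Pt , λ { Pu here → ¬Pw Pu ; Pu (there c) → t-first Pu c }

module ArcsWithin {P : Pred (Fin m) p} (P? : Decidable P) {l : List (Fin m)} (l! : Unique l) where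

  Arc : Fin m → Fin m → Set p
  Arc u v = P u × P v × Consecutive l u v

  arc? : ∀ u v → Dec (Arc u v)
  arc? u v = P? u ×-dec P? v ×-dec consecutive? _≟_ l u v

  visited? : ∀ v → Dec (P v × v ∈ₗ l)
  visited? v = P? v ×-dec any? (v ≟_) l

  arcsInto-≤ : ∀ v → ∑[ u < m ] 𝟙 (arc? u v) ≤ 𝟙 (visited? v)
  arcsInto-≤ v with visited? v
  ... | yes _ = ∑-𝟙-≤1 (λ u → arc? u v)
                  λ (_ , _ , u→v) (_ , _ , u′→v) → predecessor-unique l! u→v u′→v
  ... | no ¬visited = ≤-reflexive (∑-≡0 λ u →
                        𝟙-no (arc? u v) λ (_ , Pv , u→v) → ¬visited (Pv , Consecutive⇒∈ʳ u→v))

  arcsInto-first-< : ∀ {t} → P t → t ∈ₗ l → (∀ {u} → P u → ¬ Consecutive l u t) →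
                     ∑[ u < m ] 𝟙 (arc? u t) < 𝟙 (visited? t)
  arcsInto-first-< {t} Pt t∈l t-first =
    subst₂ _<_ (sym (∑-≡0 λ u → 𝟙-no (arc? u t) λ (Pu , _ , u→t) → t-first Pu u→t))
               (sym (𝟙-yes (visited? t) (Pt , t∈l)))
               ≤-refl

  ∑-arcs-< : ∀ {v} → v ∈ₗ l → P v →
             ∑[ u < m ] ∑[ w < m ] 𝟙 (arc? u w) < ∑[ w < m ] 𝟙 (visited? w)
  ∑-arcs-< v∈l Pv with first-satisfying P? l! v∈l Pv
  ... | t , t∈l , Pt , t-first =
        subst₂ _<_ (sym (∑-comm λ u w → 𝟙 (arc? u w))) refl
                   (∑-mono-< arcsInto-≤ t (arcsInto-first-< Pt t∈l t-first))

module TruckTour {n} {Vd : Subset (suc (suc n))} {x : V n → V n → Bool} {y : V n → Bool}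
                 (feasible : Feasible n Vd x y)
                 (S : Subset (suc (suc n))) (S⊆Vc : ∀ i → i ∈ S → IsCustomer i) where

  open Feasible feasible

  N : ℕ
  N = suc (suc n)

  tour : List (V n)
  tour = depot ∷ interior ++ [ depot' ]

  open ArcsWithin (_∈? S) simple public

  customer-∈-tour⇒∈-interior : ∀ {v} → IsCustomer v → v ∈ₗ tour → v ∈ₗ interior
  customer-∈-tour⇒∈-interior (v≢0 , _) (here v≡0) = ⊥-elim (v≢0 v≡0)
  customer-∈-tour⇒∈-interior (_ , v≢n+1) (there v∈) with ∈-++⁻ interior v∈
  ... | inj₁ v∈interior     = v∈interior
  ... | inj₂ (here v≡n+1) = ⊥-elim (v≢n+1 v≡n+1)

  ∈-tour⇒y≡true : ∀ {v} → v ∈ S → v ∈ₗ tour → y v ≡ true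
  ∈-tour⇒y≡true v∈S v∈tour =
    Equivalence.to (interiorY _ (S⊆Vc _ v∈S)) (customer-∈-tour⇒∈-interior (S⊆Vc _ v∈S) v∈tour)

  truck-∈-tour : ∀ {v} → v ∈ S → v ∉ Vd → v ∈ₗ tour
  truck-∈-tour v∈S v∉Vd =
    there (∈-++⁺ˡ (Equivalence.from (interiorY _ (S⊆Vc _ v∈S)) (truck _ (S⊆Vc _ v∈S) v∉Vd)))

  x-≤-arcs : ∀ {i j} → i ∈ S → j ∈ S → i F.< j → b2n (x i j) ≤ 𝟙 (arc? i j) + 𝟙 (arc? j i)
  x-≤-arcs {i} {j} i∈S j∈S i<j with x i j in xij
  ... | false = z≤n
  ... | true with Equivalence.to (incidence i j i<j) xij
  ...   | inj₁ i→j = ≤-trans (≤-reflexive (sym (𝟙-yes (arc? i j) (i∈S , j∈S , i→j)))) (m≤m+n _ _)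
  ...   | inj₂ j→i = ≤-trans (≤-reflexive (sym (𝟙-yes (arc? j i) (j∈S , i∈S , j→i)))) (m≤n+m _ _)

  edgeTerm : V n → V n → ℕ
  edgeTerm i j = if ⌊ i ∈? S ⌋ ∧ ⌊ j ∈? S ⌋ ∧ ⌊ i F.<? j ⌋ then b2n (x i j) else 0

  vertexTerm : V n → ℕ
  vertexTerm v = if ⌊ v ∈? S ⌋ then b2n (y v) else 0

  edgeSum≡∑∑edgeTerm : edgeSum S x ≡ ∑[ i < N ] ∑[ j < N ] edgeTerm i j
  edgeSum≡∑∑edgeTerm = trans (lsum-map-allFin (λ i → lsum (map (edgeTerm i) (allFin N))))
                             (sum-cong-≗ λ i → lsum-map-allFin (edgeTerm i))

  ySum≡∑vertexTerm : ySum S y ≡ ∑[ v < N ] vertexTerm v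
  ySum≡∑vertexTerm = lsum-map-allFin vertexTerm

  edge-≤-arcs : ∀ i j → edgeTerm i j ≤ 𝟙 (i F.<? j) * (𝟙 (arc? i j) + 𝟙 (arc? j i))
  edge-≤-arcs i j = bound (i ∈? S) (j ∈? S) (i F.<? j)
    where
    bound : (i∈S? : Dec (i ∈ S)) (j∈S? : Dec (j ∈ S)) (i<j? : Dec (i F.< j)) →
            (if ⌊ i∈S? ⌋ ∧ ⌊ j∈S? ⌋ ∧ ⌊ i<j? ⌋ then b2n (x i j) else 0)
            ≤ 𝟙 i<j? * (𝟙 (arc? i j) + 𝟙 (arc? j i))
    bound (yes i∈S) (yes j∈S) (yes i<j) =
      ≤-trans (x-≤-arcs i∈S j∈S i<j) (≤-reflexive (sym (*-identityˡ _)))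
    bound (yes _) (yes _) (no _) = z≤n
    bound (yes _) (no _)  _      = z≤n
    bound (no _)  _       _      = z≤n

  visited-≤-y : ∀ v → 𝟙 (visited? v) ≤ vertexTerm v
  visited-≤-y v = bound (v ∈? S)
    where
    bound : (v∈S? : Dec (v ∈ S)) → 𝟙 (v∈S? ×-dec any? (v ≟_) tour)
                                   ≤ (if ⌊ v∈S? ⌋ then b2n (y v) else 0)
    bound (no _) = z≤n
    bound (yes v∈S) with any? (v ≟_) tour
    ... | no _       = z≤n
    ... | yes v∈tour = ≤-reflexive (cong b2n (sym (∈-tour⇒y≡true v∈S v∈tour)))

proposition5 : (n : ℕ) (Vd : Subset (suc (suc n))) →
    (∀ i → i ∈ Vd → IsCustomer i) →
    (S : Subset (suc (suc n))) →
    (∀ i → i ∈ S → IsCustomer i) →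
    Σ (V n) (λ i → i ∈ S × i ∉ Vd) →
    3 ≤ ∣ S ∣ →
    (x : V n → V n → Bool) (y : V n → Bool) →
    Feasible n Vd x y →
    edgeSum S x + 1 ≤ ySum S y
proposition5 _ _ _ S S⊆Vc (t , t∈S , t∉Vd) _ x y feasible = begin
  edgeSum S x + 1
    ≡⟨ +-comm _ 1 ⟩
  suc (edgeSum S x)
    ≡⟨ cong suc edgeSum≡∑∑edgeTerm ⟩
  suc (∑[ i < N ] ∑[ j < N ] edgeTerm i j)
    ≤⟨ s≤s (∑-mono-≤ λ i → ∑-mono-≤ λ j → edge-≤-arcs i j) ⟩
  suc (∑[ i < N ] ∑[ j < N ] (𝟙 (i F.<? j) * (𝟙 (arc? i j) + 𝟙 (arc? j i))))
    ≤⟨ s≤s (∑∑-upperTriangle-≤ λ i j → 𝟙 (arc? i j)) ⟩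
  suc (∑[ i < N ] ∑[ j < N ] 𝟙 (arc? i j))
    ≤⟨ ∑-arcs-< (truck-∈-tour t∈S t∉Vd) t∈S ⟩
  ∑[ v < N ] 𝟙 (visited? v)
    ≤⟨ ∑-mono-≤ visited-≤-y ⟩
  ∑[ v < N ] vertexTerm v
    ≡⟨ sym ySum≡∑vertexTerm ⟩
  ySum S y ∎
  where
  open ≤-Reasoning
  open TruckTour feasible S S⊆Vc
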